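{- For every integer $k\ge 2$, there are only finitely many connected graphs $G$ (up to isomorphism) such that $\mathrm{rank}_d(G)=k$.
   Context: All graphs are finite, simple (no loops, no multiple edges). For a connected graph $G$ with vertices $v_1,\dots,v_n$, the distance matrix $D(G)$ is the $n\times n$ matrix whose $(i,j)$-entry is $d_G(v_i,v_j)$, the number of edges of a shortest path between $v_i$ and $v_j$. The distance rank $\mathrm{rank}_d(G)$ is the rank of $D(G)$. -}

module Defs where

open import Data.Nat using (ℕ; zero; suc; _<_)
open import Data.Fin using (Fin; zero; suc)
open import Data.Bool using (Bool; true; false)
open import Data.Integer using (+_)
open import Data.Rational using (ℚ; 0ℚ; _+_; _*_; _/_)
open import Data.Product using (Σ; ∃; ∃-syntax; _×_; _,_)
open import Relation.Binary.PropositionalEquality using (_≡_)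
open import Relation.Nullary using (¬_)
open import Function.Bundles using (_↔_; Inverse)
open import Function.Definitions using (Injective)

record Graph (n : ℕ) : Set where
  field
    adj    : Fin n → Fin n → Bool
    sym    : ∀ i j → adj i j ≡ adj j i
    irrefl : ∀ i → adj i i ≡ false
open Graph public

data Walk {n : ℕ} (G : Graph n) : Fin n → Fin n → ℕ → Set where
  here : ∀ {u} → Walk G u u 0
  step : ∀ {u w v m} → adj G u w ≡ true → Walk G w v m → Walk G u v (suc m)

Connected : ∀ {n} → Graph n → Set
Connected G = ∀ u v → ∃[ m ] Walk G u v m

IsDist : ∀ {n} → Graph n → Fin n → Fin n → ℕ → Set
IsDist G u v d = Walk G u v d × (∀ m → m < d → ¬ Walk G u v m)

IsDistanceMatrix : ∀ {n} → Graph n → (Fin n → Fin n → ℕ) → Set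
IsDistanceMatrix G D = ∀ u v → IsDist G u v (D u v)

sumℚ : ∀ {k} → (Fin k → ℚ) → ℚ
sumℚ {zero}  f = 0ℚ
sumℚ {suc k} f = f zero + sumℚ (λ i → f (suc i))

RowsIndependent : ∀ {n k} → (Fin n → Fin n → ℚ) → (Fin k → Fin n) → Set
RowsIndependent M σ =
  ∀ (c : Fin _ → ℚ) → (∀ j → sumℚ (λ i → c i * M (σ i) j) ≡ 0ℚ) → ∀ i → c i ≡ 0ℚ

HasRank : ∀ {n} → (Fin n → Fin n → ℚ) → ℕ → Set
HasRank {n} M k =
  (∃[ σ ] (Injective _≡_ _≡_ σ × RowsIndependent {n} {k} M σ))
  × (∀ (τ : Fin (suc k) → Fin n) → Injective _≡_ _≡_ τ → ¬ RowsIndependent M τ)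

toℚ : ℕ → ℚ
toℚ m = (+ m) / 1

_≅_ : ∀ {n m} → Graph n → Graph m → Set
_≅_ {n} {m} G H = Σ (Fin n ↔ Fin m) λ f →
  ∀ i j → adj G i j ≡ adj H (Inverse.to f i) (Inverse.to f j)

-- Let D be the distance matrix of G and k its rank.  If two vertices a, b were at
-- distance ≥ k, the first k + 1 vertices of a shortest a–b path would have the
-- path distances ∣ i - j ∣ among themselves, and the distance matrix of a path is
-- nonsingular; so these k + 1 rows of D would be independent.  Hence every distance
-- is < k.  Next fix k independent rows σ of D.  A vertex u is determined by its
-- distances to σ: if u ≠ v had the same ones, row u together with σ would be
-- k + 1 independent rows (evaluate a vanishing combination at the columns u and v).
-- So u ↦ (D (σ i) u)ᵢ injects the vertices into Fin k → Fin k, whence n ≤ k ^ k,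
-- and there are finitely many graphs of bounded order.
module Submission where

open import Defs hiding (sym)
open import Data.Bool using (Bool; not; _∧_; if_then_else_)
open import Data.Bool.Properties using (∧-comm; ∧-idem)
open import Data.Fin using (Fin; zero; suc; toℕ; fromℕ; fromℕ<; funToFin; finToFun)
open import Data.Fin.Properties
  using (toℕ-injective; toℕ-fromℕ; toℕ-fromℕ<; toℕ≤pred[n]; suc-injective; injective⇒≤;
         finToFun-funToFin; 2↔Bool)
  renaming (_≟_ to _≟ᶠ_)
import Data.Integer as ℤ
import Data.Integer.Properties as ℤ
open import Data.List using (List; map; concatMap; allFin; upTo)
open import Data.List.Membership.Propositional.Properties using (∈-allFin; ∈-upTo⁺)
open import Data.List.Relation.Unary.Any as Any using (Any)
open import Data.List.Relation.Unary.Any.Properties using (map⁺; concat⁺)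
open import Data.Nat as ℕ using (ℕ; zero; suc; _≤_; _<_; _∸_; _^_; ∣_-_∣; z≤n; s≤s)
open import Data.Nat.Coprimality using (1-coprimeTo) renaming (sym to coprime-sym)
import Data.Nat.Properties as ℕ
open import Data.Product using (Σ; ∃-syntax; _,_; proj₁; proj₂)
open import Data.Rational using (ℚ; 0ℚ; 1ℚ; _+_; _*_; mkℚ; ↥_; 1/_; ≢-nonZero)
open import Data.Rational.Properties
  using (normalize-coprime; +-identityˡ; +-identityʳ; *-zeroˡ; *-zeroʳ; *-identityʳ;
         *-assoc; *-inverseʳ; *-distribˡ-+; +-0-commutativeMonoid)
open import Data.Sum using (_⊎_; inj₁; inj₂)
open import Data.Vec.Functional using (_∷_)
open import Function using (id; _∘_; Injective; Inverse; mk⇔)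
open import Function.Construct.Identity using (↔-id)
open import Relation.Binary.PropositionalEquality
  using (_≡_; _≢_; _≗_; refl; sym; trans; cong; cong₂; subst; module ≡-Reasoning)
open import Relation.Nullary using (¬_; yes; no; does; contradiction)
open import Relation.Nullary.Decidable using (dec-true; dec-false; does-⇔)
open import Algebra.Bundles using (CommutativeMonoid)
open import Algebra.Properties.CommutativeSemigroup
  (CommutativeMonoid.commutativeSemigroup +-0-commutativeMonoid) using (interchange)

toℚ≡mkℚ : ∀ m → toℚ m ≡ mkℚ (ℤ.+ m) 0 (coprime-sym (1-coprimeTo m))
toℚ≡mkℚ m = normalize-coprime (coprime-sym (1-coprimeTo m))

toℚ-+ : ∀ a b → toℚ (a ℕ.+ b) ≡ toℚ a + toℚ b
toℚ-+ a b rewrite toℚ≡mkℚ a | toℚ≡mkℚ b =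
  cong (λ z → z Data.Rational./ 1) (sym numerator)
  where
  numerator : (ℤ.+ a) ℤ.* (ℤ.+ 1) ℤ.+ (ℤ.+ b) ℤ.* (ℤ.+ 1) ≡ ℤ.+ (a ℕ.+ b)
  numerator rewrite ℤ.*-identityʳ (ℤ.+ a) | ℤ.*-identityʳ (ℤ.+ b) = refl

toℚ≡0⇒≡0 : ∀ d → toℚ d ≡ 0ℚ → d ≡ 0
toℚ≡0⇒≡0 zero    _ = refl
toℚ≡0⇒≡0 (suc d) eq with cong ↥_ (trans (sym (toℚ≡mkℚ (suc d))) eq)
... | ()

toℚ-≢0 : ∀ {d} → d ≢ 0 → toℚ d ≢ 0ℚ
toℚ-≢0 {d} d≢0 = d≢0 ∘ toℚ≡0⇒≡0 d

p*q≡0⇒p≡0 : ∀ {q} → q ≢ 0ℚ → ∀ p → p * q ≡ 0ℚ → p ≡ 0ℚ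
p*q≡0⇒p≡0 {q} q≢0 p pq≡0 = begin
  p              ≡⟨ *-identityʳ p ⟨
  p * 1ℚ         ≡⟨ cong (p *_) (*-inverseʳ q) ⟨
  p * (q * 1/ q) ≡⟨ *-assoc p q (1/ q) ⟨
  (p * q) * 1/ q ≡⟨ cong (_* 1/ q) pq≡0 ⟩
  0ℚ * 1/ q      ≡⟨ *-zeroˡ (1/ q) ⟩
  0ℚ             ∎
  where
  open ≡-Reasoning
  instance _ = ≢-nonZero q≢0

sumℚ-cong : ∀ {k} {f g : Fin k → ℚ} → f ≗ g → sumℚ f ≡ sumℚ g
sumℚ-cong {zero} f≗g = refl
sumℚ-cong {suc k} f≗g = cong₂ _+_ (f≗g zero) (sumℚ-cong (λ i → f≗g (suc i)))

sumℚ-+ : ∀ {k} (f g : Fin k → ℚ) → sumℚ (λ i → f i + g i) ≡ sumℚ f + sumℚ g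
sumℚ-+ {zero} f g = refl
sumℚ-+ {suc k} f g = trans
  (cong ((f zero + g zero) +_) (sumℚ-+ (λ i → f (suc i)) (λ i → g (suc i))))
  (interchange (f zero) (g zero) _ _)

sumℚ-zero : ∀ {k} (f : Fin k → ℚ) → (∀ i → f i ≡ 0ℚ) → sumℚ f ≡ 0ℚ
sumℚ-zero {zero} f f≡0 = refl
sumℚ-zero {suc k} f f≡0
  rewrite f≡0 zero | sumℚ-zero (λ i → f (suc i)) (λ i → f≡0 (suc i)) = refl

sumℚ-single : ∀ {k} (f : Fin k → ℚ) i₀ → (∀ i → i ≢ i₀ → f i ≡ 0ℚ) → sumℚ f ≡ f i₀
sumℚ-single {suc k} f zero f≡0
  rewrite sumℚ-zero (λ i → f (suc i)) (λ i → f≡0 (suc i) λ ()) = +-identityʳ (f zero)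
sumℚ-single {suc k} f (suc i₀) f≡0
  rewrite f≡0 zero (λ ())
        | sumℚ-single (λ i → f (suc i)) i₀ (λ i i≢i₀ → f≡0 (suc i) (i≢i₀ ∘ suc-injective))
  = +-identityˡ (f (suc i₀))

combination : ∀ {k} → (Fin k → ℚ) → (Fin k → ℕ) → ℚ
combination c f = sumℚ (λ i → c i * toℚ (f i))

combination-cong : ∀ {k} (c : Fin k → ℚ) {f g} → f ≗ g → combination c f ≡ combination c g
combination-cong c f≗g = sumℚ-cong (λ i → cong (λ x → c i * toℚ x) (f≗g i))

combination-+ : ∀ {k} (c : Fin k → ℚ) f g →
  combination c (λ i → f i ℕ.+ g i) ≡ combination c f + combination c g
combination-+ c f g = trans
  (sumℚ-cong (λ i → trans (cong (c i *_) (toℚ-+ (f i) (g i)))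
                           (*-distribˡ-+ (c i) (toℚ (f i)) (toℚ (g i)))))
  (sumℚ-+ (λ i → c i * toℚ (f i)) (λ i → c i * toℚ (g i)))

combination-single : ∀ {k} (c : Fin k → ℚ) f i₀ →
  (∀ i → i ≢ i₀ → f i ≡ 0 ⊎ c i ≡ 0ℚ) → combination c f ≡ c i₀ * toℚ (f i₀)
combination-single c f i₀ vanish = sumℚ-single _ i₀ λ i i≢i₀ → term-zero i (vanish i i≢i₀)
  where
  term-zero : ∀ i → f i ≡ 0 ⊎ c i ≡ 0ℚ → c i * toℚ (f i) ≡ 0ℚ
  term-zero i (inj₁ fi≡0) rewrite fi≡0 = *-zeroʳ (c i)
  term-zero i (inj₂ ci≡0) rewrite ci≡0 = *-zeroˡ (toℚ (f i))

δ₂ : ℕ → ℕ → ℕ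
δ₂ i j = if does (i ℕ.≟ j) then 2 else 0

∣-∣-secondDifference : ∀ i j →
  ∣ i - j ∣ ℕ.+ ∣ i - suc (suc j) ∣ ≡ (∣ i - suc j ∣ ℕ.+ ∣ i - suc j ∣) ℕ.+ δ₂ i (suc j)
∣-∣-secondDifference zero j = trans (ℕ.+-suc j (suc j)) (sym (ℕ.+-identityʳ _))
∣-∣-secondDifference (suc zero) zero = refl
∣-∣-secondDifference (suc (suc i)) zero
  rewrite ℕ.∣-∣-identityʳ i = sym (trans (ℕ.+-identityʳ _) (cong suc (ℕ.+-suc i i)))
∣-∣-secondDifference (suc i) (suc j) = ∣-∣-secondDifference i j

-- Second differences of j ↦ Σᵢ cᵢ ∣ i - j ∣ isolate 2 c_{j+1}, so the interior
-- coefficients vanish; the values at j = m and j = 0 then isolate c₀ and c_m.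
module PathCombination {m : ℕ} (c : Fin (suc m) → ℚ) where

  open ≡-Reasoning

  distanceTo : ℕ → Fin (suc m) → ℕ
  distanceTo j i = ∣ toℕ i - j ∣

  pathCombination : ℕ → ℚ
  pathCombination j = combination c (distanceTo j)

  pathCombination-secondDifference : ∀ {i₀} j → toℕ i₀ ≡ suc j →
    pathCombination j + pathCombination (suc (suc j))
      ≡ (pathCombination (suc j) + pathCombination (suc j)) + c i₀ * toℚ 2
  pathCombination-secondDifference {i₀} j i₀≡1+j = begin
    pathCombination j + pathCombination (suc (suc j))
      ≡⟨ combination-+ c (distanceTo j) (distanceTo (suc (suc j))) ⟨
    combination c (λ i → distanceTo j i ℕ.+ distanceTo (suc (suc j)) i)
      ≡⟨ combination-cong c (λ i → ∣-∣-secondDifference (toℕ i) j) ⟩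
    combination c (λ i → twice i ℕ.+ spike i)
      ≡⟨ combination-+ c twice spike ⟩
    combination c twice + combination c spike
      ≡⟨ cong₂ _+_ (combination-+ c (distanceTo (suc j)) (distanceTo (suc j)))
                   (combination-single c spike i₀ spike-vanishes) ⟩
    doubled + c i₀ * toℚ (spike i₀)
      ≡⟨ cong (λ x → doubled + c i₀ * toℚ x) spike-i₀ ⟩
    doubled + c i₀ * toℚ 2
      ∎
    where
    doubled = pathCombination (suc j) + pathCombination (suc j)
    twice spike : Fin (suc m) → ℕ
    twice i = distanceTo (suc j) i ℕ.+ distanceTo (suc j) i
    spike i = δ₂ (toℕ i) (suc j)
    spike-i₀ : spike i₀ ≡ 2
    spike-i₀ rewrite i₀≡1+j | dec-true (suc j ℕ.≟ suc j) refl = refl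
    spike-vanishes : ∀ i → i ≢ i₀ → spike i ≡ 0 ⊎ c i ≡ 0ℚ
    spike-vanishes i i≢i₀
      rewrite dec-false (toℕ i ℕ.≟ suc j)
                (λ i≡1+j → i≢i₀ (toℕ-injective (trans i≡1+j (sym i₀≡1+j))))
      = inj₁ refl

  module _ (vanishes : ∀ j → j ≤ m → pathCombination j ≡ 0ℚ) where

    interior-vanishes : ∀ {i₀} j → toℕ i₀ ≡ suc j → suc (suc j) ≤ m → c i₀ ≡ 0ℚ
    interior-vanishes {i₀} j i₀≡1+j 2+j≤m = p*q≡0⇒p≡0 (toℚ-≢0 {2} λ ()) (c i₀) (begin
      c i₀ * toℚ 2
        ≡⟨ +-identityˡ _ ⟨
      0ℚ + c i₀ * toℚ 2
        ≡⟨ cong (λ h → (h + h) + c i₀ * toℚ 2) (vanishes (suc j) (ℕ.<⇒≤ 2+j≤m)) ⟨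
      (pathCombination (suc j) + pathCombination (suc j)) + c i₀ * toℚ 2
        ≡⟨ pathCombination-secondDifference j i₀≡1+j ⟨
      pathCombination j + pathCombination (suc (suc j))
        ≡⟨ cong₂ _+_ (vanishes j (ℕ.≤-trans (ℕ.n≤1+n j) (ℕ.<⇒≤ 2+j≤m))) (vanishes _ 2+j≤m) ⟩
      0ℚ
        ∎)

    endpoint-or-vanishes : ∀ i → toℕ i ≡ 0 ⊎ toℕ i ≡ m ⊎ c i ≡ 0ℚ
    endpoint-or-vanishes i with toℕ i in i≡ | toℕ≤pred[n] i
    ... | zero  | _ = inj₁ refl
    ... | suc j | 1+j≤m with suc j ℕ.≟ m
    ...   | yes 1+j≡m = inj₂ (inj₁ 1+j≡m)
    ...   | no 1+j≢m = inj₂ (inj₂ (interior-vanishes j i≡ (ℕ.≤∧≢⇒< 1+j≤m 1+j≢m)))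

    module _ (m≢0 : m ≢ 0) where

      first-vanishes : c zero ≡ 0ℚ
      first-vanishes = p*q≡0⇒p≡0 (toℚ-≢0 m≢0) (c zero)
        (trans (sym (combination-single c (distanceTo m) zero others)) (vanishes m ℕ.≤-refl))
        where
        others : ∀ i → i ≢ zero → distanceTo m i ≡ 0 ⊎ c i ≡ 0ℚ
        others i i≢0 with endpoint-or-vanishes i
        ... | inj₁ i≡0 = contradiction (toℕ-injective i≡0) i≢0
        ... | inj₂ (inj₁ i≡m) rewrite i≡m = inj₁ (ℕ.∣n-n∣≡0 m)
        ... | inj₂ (inj₂ ci≡0) = inj₂ ci≡0

      last-vanishes : c (fromℕ m) ≡ 0ℚ
      last-vanishes = p*q≡0⇒p≡0 (toℚ-≢0 m≢0) (c (fromℕ m)) (begin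
        c (fromℕ m) * toℚ m
          ≡⟨ cong (λ x → c (fromℕ m) * toℚ x) (trans (ℕ.∣-∣-identityʳ _) (toℕ-fromℕ m)) ⟨
        c (fromℕ m) * toℚ (distanceTo 0 (fromℕ m))
          ≡⟨ combination-single c (distanceTo 0) (fromℕ m) others ⟨
        pathCombination 0
          ≡⟨ vanishes 0 z≤n ⟩
        0ℚ
          ∎)
        where
        others : ∀ i → i ≢ fromℕ m → distanceTo 0 i ≡ 0 ⊎ c i ≡ 0ℚ
        others i i≢m with endpoint-or-vanishes i
        ... | inj₁ i≡0 = inj₁ (trans (ℕ.∣-∣-identityʳ _) i≡0)
        ... | inj₂ (inj₁ i≡m) = contradiction (toℕ-injective (trans i≡m (sym (toℕ-fromℕ m)))) i≢m
        ... | inj₂ (inj₂ ci≡0) = inj₂ ci≡0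

      coefficients-vanish : ∀ i → c i ≡ 0ℚ
      coefficients-vanish i with endpoint-or-vanishes i
      ... | inj₁ i≡0 = subst (λ i → c i ≡ 0ℚ) (sym (toℕ-injective i≡0)) first-vanishes
      ... | inj₂ (inj₁ i≡m) =
        subst (λ i → c i ≡ 0ℚ) (toℕ-injective (trans (toℕ-fromℕ m) (sym i≡m))) last-vanishes
      ... | inj₂ (inj₂ ci≡0) = ci≡0

pathDistance : ∀ {n} → Fin n → Fin n → ℚ
pathDistance i j = toℚ ∣ toℕ i - toℕ j ∣

pathDistance-rowsIndependent : ∀ m → RowsIndependent {suc (suc m)} pathDistance id
pathDistance-rowsIndependent m c combination≡0 = coefficients-vanish vanishes (λ ())
  where
  open PathCombination c
  vanishes : ∀ j → j ≤ suc m → pathCombination j ≡ 0ℚ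
  vanishes j j≤1+m = subst (λ t → pathCombination t ≡ 0ℚ) (toℕ-fromℕ< (s≤s j≤1+m))
                           (combination≡0 (fromℕ< (s≤s j≤1+m)))

rowsIndependent-restrict : ∀ {n m} {M : Fin n → Fin n → ℚ} {N : Fin m → Fin m → ℚ}
  (τ : Fin m → Fin n) →
  (∀ i j → M (τ i) (τ j) ≡ N i j) → RowsIndependent N id → RowsIndependent M τ
rowsIndependent-restrict τ M≡N N-independent c combination≡0 =
  N-independent c λ j → trans (sumℚ-cong λ i → cong (c i *_) (sym (M≡N i j))) (combination≡0 (τ j))

∷-injective : ∀ {n k} {u : Fin n} {σ : Fin k → Fin n} →
  Injective _≡_ _≡_ σ → (∀ i → σ i ≢ u) → Injective _≡_ _≡_ (u ∷ σ)
∷-injective σ-inj u∉σ {zero}  {zero}  _     = refl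
∷-injective σ-inj u∉σ {zero}  {suc j} u≡σj  = contradiction (sym u≡σj) (u∉σ j)
∷-injective σ-inj u∉σ {suc i} {zero}  σi≡u  = contradiction σi≡u (u∉σ i)
∷-injective σ-inj u∉σ {suc i} {suc j} σi≡σj = cong suc (σ-inj σi≡σj)

rowsIndependent-∷ : ∀ {n k} {M : Fin n → Fin n → ℚ} {σ : Fin k → Fin n} {u v} →
  RowsIndependent M σ → M u u ≡ 0ℚ → M u v ≢ 0ℚ → (∀ i → M (σ i) u ≡ M (σ i) v) →
  RowsIndependent M (u ∷ σ)
rowsIndependent-∷ {M = M} {σ} {u} {v} σ-independent Muu≡0 Muv≢0 σ-blind c combination≡0 = all-vanish
  where
  open ≡-Reasoning
  rest : ∀ j → ℚ
  rest j = sumℚ (λ i → c (suc i) * M (σ i) j)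
  rest-vanishes-if : ∀ j → c zero * M u j ≡ 0ℚ → rest j ≡ 0ℚ
  rest-vanishes-if j head≡0 = begin
    rest j                  ≡⟨ +-identityˡ (rest j) ⟨
    0ℚ + rest j             ≡⟨ cong (_+ rest j) head≡0 ⟨
    c zero * M u j + rest j ≡⟨ combination≡0 j ⟩
    0ℚ                      ∎
  head-vanishes : c zero ≡ 0ℚ
  head-vanishes = p*q≡0⇒p≡0 Muv≢0 (c zero) (begin
    c zero * M u v          ≡⟨ +-identityʳ _ ⟨
    c zero * M u v + 0ℚ     ≡⟨ cong (c zero * M u v +_) rest-v≡0 ⟨
    c zero * M u v + rest v ≡⟨ combination≡0 v ⟩
    0ℚ                      ∎)
    where
    rest-v≡0 : rest v ≡ 0ℚ
    rest-v≡0 = trans (sumℚ-cong λ i → cong (c (suc i) *_) (sym (σ-blind i)))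
                     (rest-vanishes-if u (trans (cong (c zero *_) Muu≡0) (*-zeroʳ (c zero))))
  all-vanish : ∀ i → c i ≡ 0ℚ
  all-vanish zero    = head-vanishes
  all-vanish (suc i) = σ-independent (c ∘ suc)
    (λ j → rest-vanishes-if j (trans (cong (_* M u j) head-vanishes) (*-zeroˡ (M u j)))) i

maximalIndependentRows-separate : ∀ {n k} {M : Fin n → Fin n → ℚ} {σ : Fin k → Fin n} →
  (∀ u → M u u ≡ 0ℚ) → (∀ u v → M u v ≡ 0ℚ → u ≡ v) →
  Injective _≡_ _≡_ σ → RowsIndependent M σ →
  (∀ (τ : Fin (suc k) → Fin n) → Injective _≡_ _≡_ τ → ¬ RowsIndependent M τ) →
  ∀ u v → (∀ i → M (σ i) u ≡ M (σ i) v) → u ≡ v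
maximalIndependentRows-separate {M = M} {σ} M-diag M-sep σ-inj σ-independent maximal u v σ-blind
  with u ≟ᶠ v
... | yes u≡v = u≡v
... | no u≢v = contradiction
  (rowsIndependent-∷ {M = M} σ-independent (M-diag u) (u≢v ∘ M-sep u v) σ-blind)
  (maximal (u ∷ σ) (∷-injective σ-inj u∉σ))
  where
  u∉σ : ∀ i → σ i ≢ u
  u∉σ i refl = u≢v (M-sep u v (trans (sym (σ-blind i)) (M-diag u)))

funToFin-injective : ∀ {m k} {f g : Fin m → Fin k} → funToFin f ≡ funToFin g → f ≗ g
funToFin-injective {f = f} {g} f≡g i =
  trans (sym (finToFun-funToFin f i))
        (trans (cong (λ x → finToFun x i) f≡g) (finToFun-funToFin g i))

module _ {n} {G : Graph n} where

  _++ʷ_ : ∀ {u v w a b} → Walk G u v a → Walk G v w b → Walk G u w (a ℕ.+ b)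
  here     ++ʷ q = q
  step e p ++ʷ q = step e (p ++ʷ q)

  reverseOnto : ∀ {u v w a b} → Walk G u v a → Walk G u w b → Walk G v w (a ℕ.+ b)
  reverseOnto here acc = acc
  reverseOnto {u} {b = b} (step {w = x} {m = a} e p) acc =
    subst (Walk G _ _) (ℕ.+-suc a b) (reverseOnto p (step (trans (Graph.sym G x u) e) acc))

  reverse : ∀ {u v a} → Walk G u v a → Walk G v u a
  reverse {a = a} p = subst (Walk G _ _) (ℕ.+-identityʳ a) (reverseOnto p here)

  vertexAt : ∀ {u v a} → Walk G u v a → ℕ → Fin n
  vertexAt {u} p        zero    = u
  vertexAt {u} here     (suc i) = u
  vertexAt (step e p) (suc i) = vertexAt p i

  takeʷ : ∀ {u v a} i (p : Walk G u v a) → i ≤ a → Walk G u (vertexAt p i) i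
  takeʷ zero    p          _         = here
  takeʷ (suc i) (step e p) (s≤s i≤a) = step e (takeʷ i p i≤a)

  dropʷ : ∀ {u v a} i (p : Walk G u v a) → Walk G (vertexAt p i) v (a ∸ i)
  dropʷ zero    p          = p
  dropʷ (suc i) here       = here
  dropʷ (suc i) (step e p) = dropʷ i p

  vertexAt-dropʷ : ∀ {u v a} i l (p : Walk G u v a) → vertexAt (dropʷ i p) l ≡ vertexAt p (i ℕ.+ l)
  vertexAt-dropʷ zero    l       p          = refl
  vertexAt-dropʷ (suc i) zero    here       = refl
  vertexAt-dropʷ (suc i) (suc l) here       = refl
  vertexAt-dropʷ (suc i) l       (step e p) = vertexAt-dropʷ i l p

  segment : ∀ {u v a} (p : Walk G u v a) {i j} → i ≤ j → j ≤ a →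
    Walk G (vertexAt p i) (vertexAt p j) (j ∸ i)
  segment p {i} {j} i≤j j≤a =
    subst (λ w → Walk G (vertexAt p i) w (j ∸ i))
          (trans (vertexAt-dropʷ i (j ∸ i) p) (cong (vertexAt p) (ℕ.m+[n∸m]≡n i≤j)))
          (takeʷ (j ∸ i) (dropʷ i p) (ℕ.∸-monoˡ-≤ i j≤a))

module DistanceMatrix {n} {G : Graph n} {D : Fin n → Fin n → ℕ} (isD : IsDistanceMatrix G D) where

  shortestWalk : ∀ u v → Walk G u v (D u v)
  shortestWalk u v = proj₁ (isD u v)

  D-minimal : ∀ {u v a} → Walk G u v a → D u v ≤ a
  D-minimal {u} {v} {a} p = ℕ.≮⇒≥ λ a<D → proj₂ (isD u v) a a<D p

  D-refl : ∀ u → D u u ≡ 0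
  D-refl u = ℕ.n≤0⇒n≡0 (D-minimal here)

  D≡0⇒≡ : ∀ u v → D u v ≡ 0 → u ≡ v
  D≡0⇒≡ u v D≡0 = endpoints-≡ (subst (Walk G u v) D≡0 (shortestWalk u v))
    where
    endpoints-≡ : Walk G u v 0 → u ≡ v
    endpoints-≡ here = refl

  D-sym : ∀ u v → D u v ≡ D v u
  D-sym u v =
    ℕ.≤-antisym (D-minimal (reverse (shortestWalk v u))) (D-minimal (reverse (shortestWalk u v)))

  D-triangle : ∀ u v w → D u w ≤ D u v ℕ.+ D v w
  D-triangle u v w = D-minimal (shortestWalk u v ++ʷ shortestWalk v w)

  module Geodesic {a b} (p : Walk G a b (D a b)) where

    distance-≤ : ∀ {i j} → i ≤ j → j ≤ D a b → D (vertexAt p i) (vertexAt p j) ≡ j ∸ i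
    distance-≤ {i} {j} i≤j j≤ab = ℕ.≤-antisym (D-minimal (segment p i≤j j≤ab)) (begin
      j ∸ i                                   ≤⟨ ℕ.∸-monoˡ-≤ i j≤i+x ⟩
      (i ℕ.+ x) ∸ i                           ≡⟨ ℕ.m+n∸m≡n i x ⟩
      x                                       ∎)
      where
      open ℕ.≤-Reasoning
      x = D (vertexAt p i) (vertexAt p j)
      ab≤ : D a b ≤ (i ℕ.+ x) ℕ.+ (D a b ∸ j)
      ab≤ = begin
        D a b
          ≤⟨ D-triangle a (vertexAt p i) b ⟩
        D a (vertexAt p i) ℕ.+ D (vertexAt p i) b
          ≤⟨ ℕ.+-mono-≤ (D-minimal (takeʷ i p (ℕ.≤-trans i≤j j≤ab)))
                        (D-triangle _ (vertexAt p j) b) ⟩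
        i ℕ.+ (x ℕ.+ D (vertexAt p j) b)
          ≤⟨ ℕ.+-monoʳ-≤ i (ℕ.+-monoʳ-≤ x (D-minimal (dropʷ j p))) ⟩
        i ℕ.+ (x ℕ.+ (D a b ∸ j))
          ≡⟨ ℕ.+-assoc i x _ ⟨
        (i ℕ.+ x) ℕ.+ (D a b ∸ j)
          ∎
      j≤i+x : j ≤ i ℕ.+ x
      j≤i+x = ℕ.+-cancelʳ-≤ (D a b ∸ j) j (i ℕ.+ x)
                (subst (_≤ (i ℕ.+ x) ℕ.+ (D a b ∸ j)) (sym (ℕ.m+[n∸m]≡n j≤ab)) ab≤)

    distance : ∀ {i j} → i ≤ D a b → j ≤ D a b → D (vertexAt p i) (vertexAt p j) ≡ ∣ i - j ∣
    distance {i} {j} i≤ab j≤ab with ℕ.≤-total i j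
    ... | inj₁ i≤j = trans (distance-≤ i≤j j≤ab) (sym (ℕ.m≤n⇒∣m-n∣≡n∸m i≤j))
    ... | inj₂ j≤i = begin
      D (vertexAt p i) (vertexAt p j) ≡⟨ D-sym _ _ ⟩
      D (vertexAt p j) (vertexAt p i) ≡⟨ distance-≤ j≤i i≤ab ⟩
      i ∸ j                           ≡⟨ ℕ.m≤n⇒∣m-n∣≡n∸m j≤i ⟨
      ∣ j - i ∣                       ≡⟨ ℕ.∣-∣-comm j i ⟩
      ∣ i - j ∣                       ∎
      where open ≡-Reasoning

  distance<rank : ∀ {k} → HasRank (λ i j → toℚ (D i j)) (suc k) → ∀ u v → D u v < suc k
  distance<rank {k} (_ , maximal) u v with suc k ℕ.≤? D u v
  ... | no k≰D = ℕ.≰⇒> k≰D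
  ... | yes k≤D = contradiction
        (rowsIndependent-restrict {M = λ i j → toℚ (D i j)} τ τ-distance
                                  (pathDistance-rowsIndependent k))
        (maximal τ τ-injective)
    where
    open Geodesic (shortestWalk u v)
    τ : Fin (suc (suc k)) → Fin n
    τ i = vertexAt (shortestWalk u v) (toℕ i)
    on-path : ∀ (i : Fin (suc (suc k))) → toℕ i ≤ D u v
    on-path i = ℕ.≤-trans (toℕ≤pred[n] i) k≤D
    τ-distance : ∀ i j → toℚ (D (τ i) (τ j)) ≡ pathDistance i j
    τ-distance i j = cong toℚ (distance (on-path i) (on-path j))
    τ-injective : Injective _≡_ _≡_ τ
    τ-injective {i} {j} τi≡τj = toℕ-injective (ℕ.∣m-n∣≡0⇒m≡n (begin
      ∣ toℕ i - toℕ j ∣ ≡⟨ distance (on-path i) (on-path j) ⟨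
      D (τ i) (τ j)     ≡⟨ cong (λ w → D w (τ j)) τi≡τj ⟩
      D (τ j) (τ j)     ≡⟨ D-refl (τ j) ⟩
      0                 ∎))
      where open ≡-Reasoning

  order≤rank^rank : ∀ {k} → HasRank (λ i j → toℚ (D i j)) (suc k) → n ≤ suc k ^ suc k
  order≤rank^rank {k} rank@((σ , σ-injective , σ-independent) , maximal) =
    injective⇒≤ code-injective
    where
    profile : Fin n → Fin (suc k) → Fin (suc k)
    profile u i = fromℕ< (distance<rank rank (σ i) u)
    code : Fin n → Fin (suc k ^ suc k)
    code u = funToFin (profile u)
    code-injective : Injective _≡_ _≡_ code
    code-injective {u} {v} code-u≡code-v = maximalIndependentRows-separate
      (λ w → cong toℚ (D-refl w)) (λ w x Dwx≡0 → D≡0⇒≡ w x (toℚ≡0⇒≡0 _ Dwx≡0))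
      σ-injective σ-independent maximal u v same-distances
      where
      same-profile : profile u ≗ profile v
      same-profile = funToFin-injective code-u≡code-v
      same-distances : ∀ i → toℚ (D (σ i) u) ≡ toℚ (D (σ i) v)
      same-distances i = cong toℚ (begin
        D (σ i) u             ≡⟨ toℕ-fromℕ< _ ⟨
        toℕ (profile u i)     ≡⟨ cong toℕ (same-profile i) ⟩
        toℕ (profile v i)     ≡⟨ toℕ-fromℕ< _ ⟩
        D (σ i) v             ∎)
        where open ≡-Reasoning

graphFromAdjacency : ∀ {n} → (Fin n → Fin n → Bool) → Graph n
graphFromAdjacency f = record
  { adj    = λ i j → not (does (i ≟ᶠ j)) ∧ (f i j ∧ f j i)
  ; sym    = λ i j → cong₂ (λ b e → not b ∧ e)
                             (does-⇔ (mk⇔ sym sym) (i ≟ᶠ j) (j ≟ᶠ i)) (∧-comm (f i j) (f j i))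
  ; irrefl = λ i → cong (λ b → not b ∧ (f i i ∧ f i i)) (dec-true (i ≟ᶠ i) refl)
  }

graphFromAdjacency-≗ : ∀ {n} (G : Graph n) {f} → (∀ i j → f i j ≡ adj G i j) →
  ∀ i j → adj G i j ≡ adj (graphFromAdjacency f) i j
graphFromAdjacency-≗ G f≗adj i j with i ≟ᶠ j
... | yes refl = irrefl G i
... | no _ rewrite f≗adj i j | f≗adj j i | Graph.sym G j i = sym (∧-idem (adj G i j))

adjacencyCode : ∀ {n} → (Fin n → Fin n → Bool) → Fin ((2 ^ n) ^ n)
adjacencyCode f = funToFin λ i → funToFin λ j → Inverse.from 2↔Bool (f i j)

decodeAdjacency : ∀ {n} → Fin ((2 ^ n) ^ n) → Fin n → Fin n → Bool
decodeAdjacency c i j = Inverse.to 2↔Bool (finToFun (finToFun c i) j)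

decodeAdjacency-adjacencyCode : ∀ {n} (f : Fin n → Fin n → Bool) i j →
  decodeAdjacency (adjacencyCode f) i j ≡ f i j
decodeAdjacency-adjacencyCode f i j = begin
  Inverse.to 2↔Bool (finToFun (finToFun (adjacencyCode f) i) j)
    ≡⟨ cong (λ r → Inverse.to 2↔Bool (finToFun r j)) (finToFun-funToFin _ i) ⟩
  Inverse.to 2↔Bool (finToFun (funToFin λ j → Inverse.from 2↔Bool (f i j)) j)
    ≡⟨ cong (Inverse.to 2↔Bool) (finToFun-funToFin _ j) ⟩
  Inverse.to 2↔Bool (Inverse.from 2↔Bool (f i j))
    ≡⟨ Inverse.strictlyInverseˡ 2↔Bool (f i j) ⟩
  f i j
    ∎
  where open ≡-Reasoning

graphsOfOrder : ℕ → List (Σ ℕ Graph)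
graphsOfOrder n = map (λ c → n , graphFromAdjacency (decodeAdjacency c)) (allFin _)

graphsOfOrder-complete : ∀ {n} (G : Graph n) → Any (λ H → G ≅ proj₂ H) (graphsOfOrder n)
graphsOfOrder-complete {n} G = map⁺ (Any.map isomorphic (∈-allFin (adjacencyCode (adj G))))
  where
  isomorphic : ∀ {c} → adjacencyCode (adj G) ≡ c → G ≅ graphFromAdjacency (decodeAdjacency c)
  isomorphic refl = ↔-id (Fin n) , graphFromAdjacency-≗ G (decodeAdjacency-adjacencyCode (adj G))

graphsOfOrderAtMost : ℕ → List (Σ ℕ Graph)
graphsOfOrderAtMost N = concatMap graphsOfOrder (upTo (suc N))

graphsOfOrderAtMost-complete : ∀ {N n} → n ≤ N → (G : Graph n) →
  Any (λ H → G ≅ proj₂ H) (graphsOfOrderAtMost N)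
graphsOfOrderAtMost-complete n≤N G =
  concat⁺ (map⁺ {f = graphsOfOrder}
    (Any.map (λ { refl → graphsOfOrder-complete G }) (∈-upTo⁺ (s≤s n≤N))))

theorem1 : ∀ (k : ℕ) → 2 ≤ k →
    ∃[ L ] (∀ (n : ℕ) (G : Graph n) (D : Fin n → Fin n → ℕ) →
      Connected G → IsDistanceMatrix G D →
      HasRank (λ i j → toℚ (D i j)) k →
      Any (λ (H : Σ ℕ Graph) → G ≅ proj₂ H) L)
theorem1 (suc k) _ = graphsOfOrderAtMost (suc k ^ suc k) , λ n G D _ isD rank →
  graphsOfOrderAtMost-complete (DistanceMatrix.order≤rank^rank isD rank) G
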